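{- For $n\ge1$ and $k\in\{1,\dots,2^{n-1}\}$, let $v^n(k)=\operatorname{code}\big(\lambda(\mathrm{decode}_n(2^{n-1}+k-1))\big)$. Then for every $n\ge2$: \[ v^n(k)=2^{\binom{n-1}{2}}(k-1)+\begin{cases} v^{n-1}(2^{n-2}+1-k), & k\in\{1,\dots,2^{n-2}\},\\ v^{n-1}(k-2^{n-2}), & k\in\{2^{n-2}+1,\dots,2^{n-1}\},\end{cases} \] with the convention $\binom12=0$.
   Context: For $\mathbf{x}\in\{0,1\}^n$, let $\lambda(\mathbf{x})\in\{0,1\}^{\binom n2}$ have coordinates $\lambda(\mathbf{x})_{ij}=\mathbf{1}(x_i=x_j)$ for $1\le i<j\le n$, listed in lexicographic order of the pairs. For $n=1$ this is the empty vector. For a binary vector $\mathbf{y}=(y_1,\dots,y_m)$, $\operatorname{code}(\mathbf{y})=\sum_{j=1}^m y_j 2^{m-j}$, with code $0$ for the empty vector; in particular $v^1(1)=0$. For $0\le a<2^n$, $\mathrm{decode}_n(a)$ is the $n$-bit binary representation of $a$, padded with leading zeros. -}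

module Defs where

open import Data.Nat using (ℕ; zero; suc; _+_; _*_; _∸_; _^_; _/_; _%_)
open import Data.Bool using (Bool; true; false; if_then_else_)
open import Data.List using (List; []; _∷_; map; _++_; foldl)
open import Data.Bool.Properties using () renaming (_≟_ to _≟ᵇ_)
open import Relation.Nullary.Decidable using (⌊_⌋)

bit : Bool → ℕ
bit true  = 1
bit false = 0

-- code(y) = Σ y_j 2^{m-j}  (most significant bit first); code [] = 0
code : List Bool → ℕ
code = foldl (λ acc b → 2 * acc + bit b) 0

-- decode n a : the n-bit binary representation of a (MSB first, zero-padded)
decode : ℕ → ℕ → List Bool
decode zero    a = []
decode (suc n) a = decode n (a / 2) ++ ((a % 2 Data.Nat.≡ᵇ 1) ∷ [])

-- λ(x)_{ij} = 1(x_i = x_j), i<j in lexicographic order of pairs: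
-- first all pairs (1,j), then the pairs among the remaining coordinates.
lam : List Bool → List Bool
lam []       = []
lam (x ∷ xs) = map (λ y → ⌊ x ≟ᵇ y ⌋) xs ++ lam xs

v : ℕ → ℕ → ℕ
v n k = code (lam (decode n (2 ^ (n ∸ 1) + k ∸ 1)))

{-# OPTIONS --safe #-}
module Submission where

-- Write k = j + 1.  The word decode_n(2^(n-1) + j) is 1 followed by x = decode_(n-1)(j), so the
-- first n - 1 entries of λ compare the leading 1 with x and reproduce x itself, contributing
-- j · 2^C(n-1,2); the remaining entries are λ(x).  For k > 2^(n-2), λ(x) is exactly the word
-- behind v^(n-1)(k - 2^(n-2)).  For k ≤ 2^(n-2), the word behind v^(n-1)(2^(n-2) + 1 - k) is
-- decode_(n-1)(2^(n-1) - 1 - j), the bitwise complement of x, and λ cannot see complementation.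

open import Defs
open import Data.Nat using (ℕ; _+_; _*_; _∸_; _^_; _≤_)
open import Data.Nat.Combinatorics using (_C_)
open import Relation.Binary.PropositionalEquality using (_≡_)
open import Data.Product using (_×_; _,_)

open import Data.Bool using (Bool; true; false; not)
open import Data.Bool.Properties using () renaming (_≟_ to _≟ᵇ_)
open import Data.List using ([]; _∷_; _∷ʳ_; _++_; map; foldl; length)
open import Data.List.Properties using (length-++; length-map; map-cong; map-id; map-∘; foldl-++)
open import Data.List.Reverse using (Reverse; []; _∶_∶ʳ_; reverseView)
open import Data.Nat using (zero; suc; _<_; s≤s; _≡ᵇ_)
open import Data.Nat.Combinatorics using (nC1≡n; nCk+nC[k+1]≡[n+1]C[k+1])
open import Data.Nat.DivMod using (_/_; _%_; m≡m%n+[m/n]*n; m%n<n; m<n*o⇒m/o<n; +-distrib-/-∣ˡ; %-remove-+ˡ; m*n/n≡m)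
open import Data.Nat.Divisibility using (n∣m*n)
open import Data.Nat.Properties
open import Data.Nat.Tactic.RingSolver using (solve-∀)
open import Function using (_∘_)
open import Relation.Binary.PropositionalEquality using (refl; sym; trans; cong; cong₂; module ≡-Reasoning)
open import Relation.Nullary.Decidable using (⌊_⌋)

open ≡-Reasoning

shiftIn : ℕ → Bool → ℕ
shiftIn acc b = 2 * acc + bit b

foldl-shiftIn : ∀ acc ys → foldl shiftIn acc ys ≡ acc * 2 ^ length ys + code ys
foldl-shiftIn acc []       = sym (trans (+-identityʳ _) (*-identityʳ acc))
foldl-shiftIn acc (y ∷ ys) = begin
    foldl shiftIn (2 * acc + bit y) ys
  ≡⟨ foldl-shiftIn (2 * acc + bit y) ys ⟩
    (2 * acc + bit y) * 2 ^ length ys + code ys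
  ≡⟨ distrib acc (bit y) (2 ^ length ys) (code ys) ⟩
    acc * (2 * 2 ^ length ys) + (bit y * 2 ^ length ys + code ys)
  ≡⟨ cong (acc * (2 * 2 ^ length ys) +_) (foldl-shiftIn (bit y) ys) ⟨
    acc * (2 * 2 ^ length ys) + code (y ∷ ys)
  ∎
  where
  distrib : ∀ a b N c → (2 * a + b) * N + c ≡ a * (2 * N) + (b * N + c)
  distrib = solve-∀

code-++ : ∀ xs ys → code (xs ++ ys) ≡ code xs * 2 ^ length ys + code ys
code-++ xs ys = begin
  code (xs ++ ys)                    ≡⟨ foldl-++ shiftIn 0 xs ys ⟩
  foldl shiftIn (code xs) ys         ≡⟨ foldl-shiftIn (code xs) ys ⟩
  code xs * 2 ^ length ys + code ys  ∎

code-∷ : ∀ b xs → code (b ∷ xs) ≡ bit b * 2 ^ length xs + code xs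
code-∷ b = code-++ (b ∷ [])

code-∷ʳ : ∀ xs b → code (xs ∷ʳ b) ≡ code xs * 2 + bit b
code-∷ʳ xs b = code-++ xs (b ∷ [])

bit-≡ᵇ1 : ∀ {d} → d < 2 → bit (d ≡ᵇ 1) ≡ d
bit-≡ᵇ1 {0} _ = refl
bit-≡ᵇ1 {1} _ = refl
bit-≡ᵇ1 {suc (suc _)} (s≤s (s≤s ()))

decode-suc : ∀ m q b → decode (suc m) (q * 2 + bit b) ≡ decode m q ∷ʳ b
decode-suc m q b = cong₂ (λ q′ b′ → decode m q′ ∷ʳ b′) quotient remainder
  where
  quotient : (q * 2 + bit b) / 2 ≡ q
  quotient = begin
    (q * 2 + bit b) / 2    ≡⟨ +-distrib-/-∣ˡ (bit b) (n∣m*n q) ⟩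
    q * 2 / 2 + bit b / 2  ≡⟨ cong₂ _+_ (m*n/n≡m q 2) (bit/2≡0 b) ⟩
    q + 0                  ≡⟨ +-identityʳ q ⟩
    q                      ∎
    where
    bit/2≡0 : ∀ b → bit b / 2 ≡ 0
    bit/2≡0 false = refl
    bit/2≡0 true  = refl
  remainder : ((q * 2 + bit b) % 2 ≡ᵇ 1) ≡ b
  remainder = trans (cong (_≡ᵇ 1) (%-remove-+ˡ (bit b) (n∣m*n q))) (bit%2≡ᵇ1 b)
    where
    bit%2≡ᵇ1 : ∀ b → (bit b % 2 ≡ᵇ 1) ≡ b
    bit%2≡ᵇ1 false = refl
    bit%2≡ᵇ1 true  = refl

length-decode : ∀ m r → length (decode m r) ≡ m
length-decode zero    r = refl
length-decode (suc m) r = begin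
  length (decode m (r / 2) ∷ʳ _)  ≡⟨ length-++ (decode m (r / 2)) ⟩
  length (decode m (r / 2)) + 1   ≡⟨ cong (_+ 1) (length-decode m (r / 2)) ⟩
  m + 1                           ≡⟨ +-comm m 1 ⟩
  suc m                           ∎

code-decode : ∀ m r → r < 2 ^ m → code (decode m r) ≡ r
code-decode zero    zero    _ = refl
code-decode zero    (suc r) (s≤s ())
code-decode (suc m) r r<2^1+m = begin
    code (decode m (r / 2) ∷ʳ (r % 2 ≡ᵇ 1))
  ≡⟨ code-∷ʳ (decode m (r / 2)) (r % 2 ≡ᵇ 1) ⟩
    code (decode m (r / 2)) * 2 + bit (r % 2 ≡ᵇ 1)
  ≡⟨ cong₂ _+_ (cong (_* 2) (code-decode m (r / 2) r/2<2^m)) (bit-≡ᵇ1 (m%n<n r 2)) ⟩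
    r / 2 * 2 + r % 2
  ≡⟨ +-comm (r / 2 * 2) (r % 2) ⟩
    r % 2 + r / 2 * 2
  ≡⟨ m≡m%n+[m/n]*n r 2 ⟨
    r
  ∎
  where
  r/2<2^m : r / 2 < 2 ^ m
  r/2<2^m = m<n*o⇒m/o<n (≤-trans r<2^1+m (≤-reflexive (*-comm 2 (2 ^ m))))

decode-code : ∀ xs → decode (length xs) (code xs) ≡ xs
decode-code xs = go (reverseView xs)
  where
  go : ∀ {xs} → Reverse xs → decode (length xs) (code xs) ≡ xs
  go []             = refl
  go (xs ∶ rs ∶ʳ b) = begin
      decode (length (xs ∷ʳ b)) (code (xs ∷ʳ b))
    ≡⟨ cong₂ decode (trans (length-++ xs) (+-comm (length xs) 1)) (code-∷ʳ xs b) ⟩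
      decode (suc (length xs)) (code xs * 2 + bit b)
    ≡⟨ decode-suc (length xs) (code xs) b ⟩
      decode (length xs) (code xs) ∷ʳ b
    ≡⟨ cong (_∷ʳ b) (go rs) ⟩
      xs ∷ʳ b
    ∎

code≡⇒decode≡ : ∀ {m r} xs → length xs ≡ m → code xs ≡ r → decode m r ≡ xs
code≡⇒decode≡ xs refl refl = decode-code xs

decode-2^m+ : ∀ m j → j < 2 ^ m → decode (suc m) (2 ^ m + j) ≡ true ∷ decode m j
decode-2^m+ m j j<2^m = code≡⇒decode≡ (true ∷ xs) (cong suc (length-decode m j)) (begin
  code (true ∷ xs)                ≡⟨ code-∷ true xs ⟩
  1 * 2 ^ length xs + code xs     ≡⟨ cong₂ _+_ (*-identityˡ _) (code-decode m j j<2^m) ⟩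
  2 ^ length xs + j               ≡⟨ cong (λ l → 2 ^ l + j) (length-decode m j) ⟩
  2 ^ m + j                       ∎)
  where
  xs = decode m j

code-map-not : ∀ xs → code (map not xs) + suc (code xs) ≡ 2 ^ length xs
code-map-not []       = refl
code-map-not (b ∷ xs) = begin
    code (not b ∷ map not xs) + suc (code (b ∷ xs))
  ≡⟨ cong₂ (λ c c′ → c + suc c′) (code-∷ (not b) (map not xs)) (code-∷ b xs) ⟩
    bit (not b) * 2 ^ length (map not xs) + code (map not xs) + suc (bit b * N + code xs)
  ≡⟨ cong (λ l → bit (not b) * 2 ^ l + code (map not xs) + suc (bit b * N + code xs)) (length-map not xs) ⟩
    bit (not b) * N + code (map not xs) + suc (bit b * N + code xs)
  ≡⟨ regroup (bit (not b)) (bit b) N (code (map not xs)) (code xs) ⟩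
    (bit (not b) + bit b) * N + (code (map not xs) + suc (code xs))
  ≡⟨ cong₂ (λ s c → s * N + c) (bit-not+bit b) (code-map-not xs) ⟩
    1 * N + N
  ≡⟨ cong (_+ N) (*-identityˡ N) ⟩
    N + N
  ≡⟨ cong (N +_) (+-identityʳ N) ⟨
    2 * N
  ∎
  where
  N = 2 ^ length xs
  regroup : ∀ x y N c′ c → x * N + c′ + suc (y * N + c) ≡ (x + y) * N + (c′ + suc c)
  regroup = solve-∀
  bit-not+bit : ∀ b → bit (not b) + bit b ≡ 1
  bit-not+bit false = refl
  bit-not+bit true  = refl

decode-reflect : ∀ m j → j < 2 ^ m → decode m (2 ^ m ∸ suc j) ≡ map not (decode m j)
decode-reflect m j j<2^m = code≡⇒decode≡ (map not xs) (trans (length-map not xs) (length-decode m j)) (begin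
  code (map not xs)                        ≡⟨ m+n∸n≡m (code (map not xs)) (suc j) ⟨
  code (map not xs) + suc j ∸ suc j        ≡⟨ cong (λ c → code (map not xs) + suc c ∸ suc j) (code-decode m j j<2^m) ⟨
  code (map not xs) + suc (code xs) ∸ suc j ≡⟨ cong (_∸ suc j) (code-map-not xs) ⟩
  2 ^ length xs ∸ suc j                    ≡⟨ cong (λ l → 2 ^ l ∸ suc j) (length-decode m j) ⟩
  2 ^ m ∸ suc j                            ∎)
  where
  xs = decode m j

reflected-index : ∀ a {j} → j ≤ a → a + (a + 1 ∸ suc j) ∸ 1 ≡ 2 * a ∸ suc j
reflected-index a {j} j≤a = begin
  a + (a + 1 ∸ suc j) ∸ 1  ≡⟨ cong (λ s → a + (s ∸ suc j) ∸ 1) (+-comm a 1) ⟩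
  a + (a ∸ j) ∸ 1          ≡⟨ cong (_∸ 1) (+-∸-assoc a j≤a) ⟨
  a + a ∸ j ∸ 1            ≡⟨ ∸-+-assoc (a + a) j 1 ⟩
  a + a ∸ (j + 1)          ≡⟨ cong₂ _∸_ (cong (a +_) (+-identityʳ a)) (+-comm 1 j) ⟨
  2 * a ∸ suc j            ∎

≟-true : ∀ b → ⌊ true ≟ᵇ b ⌋ ≡ b
≟-true false = refl
≟-true true  = refl

≟-not : ∀ x y → ⌊ not x ≟ᵇ not y ⌋ ≡ ⌊ x ≟ᵇ y ⌋
≟-not false false = refl
≟-not false true  = refl
≟-not true  false = refl
≟-not true  true  = refl

lam-true-∷ : ∀ xs → lam (true ∷ xs) ≡ xs ++ lam xs
lam-true-∷ xs = cong (_++ lam xs) (trans (map-cong ≟-true xs) (map-id xs))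

lam-map-not : ∀ xs → lam (map not xs) ≡ lam xs
lam-map-not []       = refl
lam-map-not (x ∷ xs) = cong₂ _++_ (trans (sym (map-∘ xs)) (map-cong (≟-not x) xs)) (lam-map-not xs)

length-lam : ∀ xs → length (lam xs) ≡ length xs C 2
length-lam []       = refl
length-lam (x ∷ xs) = begin
    length (map _ xs ++ lam xs)
  ≡⟨ length-++ (map _ xs) ⟩
    length (map _ xs) + length (lam xs)
  ≡⟨ cong₂ _+_ (trans (length-map _ xs) (sym (nC1≡n (length xs)))) (length-lam xs) ⟩
    length xs C 1 + length xs C 2
  ≡⟨ nCk+nC[k+1]≡[n+1]C[k+1] (length xs) 1 ⟩
    suc (length xs) C 2
  ∎

code-lam-true-∷ : ∀ xs → code (lam (true ∷ xs)) ≡ 2 ^ (length xs C 2) * code xs + code (lam xs)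
code-lam-true-∷ xs = begin
  code (lam (true ∷ xs))                          ≡⟨ cong code (lam-true-∷ xs) ⟩
  code (xs ++ lam xs)                             ≡⟨ code-++ xs (lam xs) ⟩
  code xs * 2 ^ length (lam xs) + code (lam xs)   ≡⟨ cong (λ l → code xs * 2 ^ l + code (lam xs)) (length-lam xs) ⟩
  code xs * 2 ^ (length xs C 2) + code (lam xs)   ≡⟨ cong (_+ code (lam xs)) (*-comm (code xs) _) ⟩
  2 ^ (length xs C 2) * code xs + code (lam xs)   ∎

v-suc-suc : ∀ m j → j < 2 ^ suc m →
  v (suc (suc m)) (suc j) ≡ 2 ^ (suc m C 2) * j + code (lam (decode (suc m) j))
v-suc-suc m j j<2^1+m = begin
    code (lam (decode (suc (suc m)) (2 ^ suc m + suc j ∸ 1)))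
  ≡⟨ cong (λ i → code (lam (decode (suc (suc m)) (i ∸ 1)))) (+-suc (2 ^ suc m) j) ⟩
    code (lam (decode (suc (suc m)) (2 ^ suc m + j)))
  ≡⟨ cong (code ∘ lam) (decode-2^m+ (suc m) j j<2^1+m) ⟩
    code (lam (true ∷ xs))
  ≡⟨ code-lam-true-∷ xs ⟩
    2 ^ (length xs C 2) * code xs + code (lam xs)
  ≡⟨ cong₂ (λ l c → 2 ^ (l C 2) * c + code (lam xs)) (length-decode (suc m) j) (code-decode (suc m) j j<2^1+m) ⟩
    2 ^ (suc m C 2) * j + code (lam xs)
  ∎
  where
  xs = decode (suc m) j

proposition4 : ∀ (n k : ℕ) → 2 ≤ n → 1 ≤ k → k ≤ 2 ^ (n ∸ 1) →
    (k ≤ 2 ^ (n ∸ 2) →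
      v n k ≡ 2 ^ ((n ∸ 1) C 2) * (k ∸ 1) + v (n ∸ 1) (2 ^ (n ∸ 2) + 1 ∸ k))
    × (2 ^ (n ∸ 2) + 1 ≤ k →
      v n k ≡ 2 ^ ((n ∸ 1) C 2) * (k ∸ 1) + v (n ∸ 1) (k ∸ 2 ^ (n ∸ 2)))
proposition4 (suc (suc m)) (suc j) (s≤s (s≤s _)) (s≤s _) j<2^1+m = lower , upper
  where
  lower : suc j ≤ 2 ^ m →
    v (suc (suc m)) (suc j) ≡ 2 ^ (suc m C 2) * j + v (suc m) (2 ^ m + 1 ∸ suc j)
  lower j<2^m = trans (v-suc-suc m j j<2^1+m) (cong (2 ^ (suc m C 2) * j +_) (sym (begin
    code (lam (decode (suc m) (2 ^ m + (2 ^ m + 1 ∸ suc j) ∸ 1)))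
      ≡⟨ cong (λ i → code (lam (decode (suc m) i))) (reflected-index (2 ^ m) (<⇒≤ j<2^m)) ⟩
    code (lam (decode (suc m) (2 ^ suc m ∸ suc j)))
      ≡⟨ cong (code ∘ lam) (decode-reflect (suc m) j j<2^1+m) ⟩
    code (lam (map not (decode (suc m) j)))
      ≡⟨ cong code (lam-map-not (decode (suc m) j)) ⟩
    code (lam (decode (suc m) j))
      ∎)))
  upper : 2 ^ m + 1 ≤ suc j →
    v (suc (suc m)) (suc j) ≡ 2 ^ (suc m C 2) * j + v (suc m) (suc j ∸ 2 ^ m)
  upper 2^m<1+j = trans (v-suc-suc m j j<2^1+m)
    (cong (λ i → 2 ^ (suc m C 2) * j + code (lam (decode (suc m) (i ∸ 1))))
      (sym (m+[n∸m]≡n (≤-trans (m≤m+n (2 ^ m) 1) 2^m<1+j))))
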